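{- If an LTL_f formula $\phi$ is realizable with respect to $\langle\mathcal{X}, \mathcal{Y}\rangle$, then the symbolic transducer $\mathcal{H} = (\mathcal{X}, \mathcal{Y}, \mathcal{Z}, Z_0, \zeta, \tau, f)$ corresponds to a winning strategy for $\phi$.
   Context: LTL_f is LTL (atoms, $\neg$, $\wedge$, $X$, $U$) interpreted over finite traces $\rho\in(2^P)^*$. Let $\mathcal{X},\mathcal{Y}$ be disjoint sets of input and output propositions with $\mathcal{X}\cup\mathcal{Y}=P$. $\phi$ is realizable w.r.t. $\langle\mathcal{X},\mathcal{Y}\rangle$ if there is a strategy $g:(2^{\mathcal{X}})^*\to 2^{\mathcal{Y}}$ such that for every infinite sequence $X_0,X_1,\ldots\in(2^{\mathcal{X}})^\omega$ there is $k\ge 0$ with $\phi$ true on the finite trace $(X_0\cup g(\epsilon)),(X_1\cup g(X_0)),\ldots,(X_k\cup g(X_0,\ldots,X_{k-1}))$. The construction: translate $\phi$ to an equivalent first-order formula over finite words, and use MONA to build a DFA $\mathcal{G}=(2^{\mathcal{X}\cup\mathcal{Y}},S,s_0,\delta,F)$ accepting exactly the traces satisfying $\phi$. Represent it as a symbolic automaton $\mathcal{F}=(\mathcal{X},\mathcal{Y},\mathcal{Z},Z_0,\eta,f)$, where $\mathcal{Z}$ is a set of $\lceil\log_2|S|\rceil$ state propositions encoding states, $Z_0$ encodes $s_0$, $\eta:2^{\mathcal{X}}\times2^{\mathcal{Y}}\times2^{\mathcal{Z}}\to2^{\mathcal{Z}}$ encodes $\delta$, and the boolean formula $f$ over $\mathcal{Z}$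 holds exactly on encodings of accepting states. Compute the fixpoint $t_0(Z,Y)=f(Z)$, $w_0(Z)=f(Z)$, $t_{i+1}(Z,Y)=t_i(Z,Y)\lor(\neg w_i(Z)\land\forall X.\,w_i(\eta(X,Y,Z)))$, $w_{i+1}(Z)=\exists Y.\,t_{i+1}(Z,Y)$, until $w_{i+1}\equiv w_i$. Applying boolean synthesis to the final $t_i$ with $\mathcal{Z}$ as inputs and $\mathcal{Y}$ as outputs yields $\tau:2^{\mathcal{Z}}\to2^{\mathcal{Y}}$ with $(Z,\tau(Z))\models t_i$ whenever some $Y$ has $(Z,Y)\models t_i$. The symbolic transducer $\mathcal{H}$ uses transition function $\zeta(Z,X)=\eta(X,\tau(Z),Z)$ and output function $\tau$. -}

module Defs where

open import Data.Nat using (ℕ; zero; suc; _<_; _≤_)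
open import Data.Nat.Logarithm using (⌈log₂_⌉)
open import Data.Bool using (Bool; true)
open import Data.Fin using (Fin; fromℕ<)
open import Data.Fin.Subset using (Subset; _∈_)
open import Data.List using (List; []; _∷_; length; lookup; map; upTo; foldl)
open import Data.Product using (Σ; ∃-syntax; _×_; _,_; proj₁; proj₂)
open import Data.Sum using (_⊎_; inj₁; inj₂)
open import Relation.Nullary using (¬_)
open import Relation.Binary.PropositionalEquality using (_≡_)
open import Function.Bundles using (_⇔_)
open import Function.Definitions using (Injective)

-- Propositions: inputs 𝒳 = Fin nx, outputs 𝒴 = Fin ny, P = 𝒳 ⊎ 𝒴.
-- A letter of 2^P is a pair (X , Y) with X ⊆ 𝒳, Y ⊆ 𝒴 (i.e. X ∪ Y).

Atom : ℕ → ℕ → Set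
Atom nx ny = Fin nx ⊎ Fin ny

Letter : ℕ → ℕ → Set
Letter nx ny = Subset nx × Subset ny

holds : ∀ {nx ny} → Letter nx ny → Atom nx ny → Set
holds (X , Y) (inj₁ x) = x ∈ X
holds (X , Y) (inj₂ y) = y ∈ Y

data LTLf (nx ny : ℕ) : Set where
  atom : Atom nx ny → LTLf nx ny
  ¬ᶠ_  : LTLf nx ny → LTLf nx ny
  _∧ᶠ_ : LTLf nx ny → LTLf nx ny → LTLf nx ny
  Xᶠ_  : LTLf nx ny → LTLf nx ny
  _Uᶠ_ : LTLf nx ny → LTLf nx ny → LTLf nx ny

Sat : ∀ {nx ny} → List (Letter nx ny) → ℕ → LTLf nx ny → Set
Sat w i (atom a) = Σ (i < length w) λ p → holds (lookup w (fromℕ< p)) a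
Sat w i (¬ᶠ φ) = ¬ Sat w i φ
Sat w i (φ ∧ᶠ ψ) = Sat w i φ × Sat w i ψ
Sat w i (Xᶠ φ) = suc i < length w × Sat w (suc i) φ
Sat w i (φ Uᶠ ψ) =
  ∃[ j ] (i ≤ j × j < length w × Sat w j ψ × (∀ k → i ≤ k → k < j → Sat w k φ))

Models : ∀ {nx ny} → List (Letter nx ny) → LTLf nx ny → Set
Models w φ = 0 < length w × Sat w 0 φ

Strategy : ℕ → ℕ → Set
Strategy nx ny = List (Subset nx) → Subset ny

prefix : ∀ {nx} → (ℕ → Subset nx) → ℕ → List (Subset nx)
prefix Xs i = map Xs (upTo i)

play : ∀ {nx ny} → Strategy nx ny → (ℕ → Subset nx) → ℕ → List (Letter nx ny)
play g Xs k = map (λ i → Xs i , g (prefix Xs i)) (upTo (suc k))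

Winning : ∀ {nx ny} → LTLf nx ny → Strategy nx ny → Set
Winning φ g = ∀ (Xs : ℕ → Subset _) → ∃[ k ] Models (play g Xs k) φ

Realizable : ∀ {nx ny} → LTLf nx ny → Set
Realizable {nx} {ny} φ = Σ (Strategy nx ny) λ g → Winning φ g

record DFA (nx ny : ℕ) : Set where
  field
    m  : ℕ
    s₀ : Fin m
    δ  : Fin m → Letter nx ny → Fin m
    F  : Subset m

δ* : ∀ {nx ny} (G : DFA nx ny) → Fin (DFA.m G) → List (Letter nx ny) → Fin (DFA.m G)
δ* G = foldl (DFA.δ G)

Accepts : ∀ {nx ny} → DFA nx ny → List (Letter nx ny) → Set
Accepts G w = δ* G (DFA.s₀ G) w ∈ DFA.F G

Recognizes : ∀ {nx ny} → DFA nx ny → LTLf nx ny → Set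
Recognizes G φ = ∀ w → Accepts G w ⇔ Models w φ

record SymAut (nx ny nz : ℕ) : Set where
  field
    Z₀ : Subset nz
    η  : Subset nx → Subset ny → Subset nz → Subset nz
    f  : Subset nz → Bool

record Encodes {nx ny} (G : DFA nx ny) (ℱ : SymAut nx ny ⌈log₂ DFA.m G ⌉) : Set where
  open DFA G
  open SymAut ℱ
  field
    enc    : Fin m → Subset ⌈log₂ m ⌉
    enc-inj : Injective _≡_ _≡_ enc
    Z₀-enc : Z₀ ≡ enc s₀
    η-enc  : ∀ X Y s → η X Y (enc s) ≡ enc (δ s (X , Y))
    f-enc  : ∀ Z → (f Z ≡ true) ⇔ (∃[ s ] (enc s ≡ Z × s ∈ F))

module Fixpoint {nx ny nz} (ℱ : SymAut nx ny nz) where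
  open SymAut ℱ

  mutual
    t : ℕ → Subset nz → Subset ny → Set
    t zero    Z Y = f Z ≡ true
    t (suc i) Z Y = t i Z Y ⊎ (¬ w i Z × (∀ (X : Subset nx) → w i (η X Y Z)))

    w : ℕ → Subset nz → Set
    w zero    Z = f Z ≡ true
    w (suc i) Z = ∃[ Y ] t (suc i) Z Y

  Stable : ℕ → Set
  Stable i = ∀ Z → w (suc i) Z ⇔ w i Z

  IsFixpointIndex : ℕ → Set
  IsFixpointIndex N = Stable N × (∀ M → M < N → ¬ Stable M)

  BoolSynth : ℕ → (Subset nz → Subset ny) → Set
  BoolSynth N τ = ∀ Z → (∃[ Y ] t N Z Y) → t N Z (τ Z)

ζ : ∀ {nx ny nz} → SymAut nx ny nz → (Subset nz → Subset ny) →
    Subset nz → Subset nx → Subset nz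
ζ ℱ τ Z X = SymAut.η ℱ X (τ Z) Z

transducerStrategy : ∀ {nx ny nz} → SymAut nx ny nz → (Subset nz → Subset ny) →
                     Strategy nx ny
transducerStrategy ℱ τ xs = τ (foldl (ζ ℱ τ) (SymAut.Z₀ ℱ) xs)

-- If the initial state lies in the fixpoint w_N (the set of states from which
-- the system can force a visit to an accepting state), τ wins: at a state of
-- layer w_{i+1} the output τ Z either accepts now or, whatever the input,
-- moves the play into layer w_i, so an accepting state is reached within N
-- steps. Otherwise stability of w_N lets the environment answer every output
-- by an input keeping the play outside w_N, hence forever non-accepting; this
-- spoils every strategy, contradicting realizability.
module Submission where

open import Defs
open import Data.Nat using (ℕ; zero; suc; _≤_; _≤′_; ≤′-refl; ≤′-step; z≤n)
open import Data.Nat.Properties using (≤-refl; <⇒≤; ≤⇒≤′; ≰⇒>; _≤?_)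
open import Data.Nat.Logarithm using (⌈log₂_⌉)
open import Data.Bool using (true)
open import Data.Bool.Properties using () renaming (_≟_ to _≟ᵇ_)
open import Data.Fin.Subset using (Subset; _∈_; ⊥)
open import Data.Fin.Subset.Properties using (anySubset?)
open import Data.List using (List; []; _∷_; _∷ʳ_; foldl; map; upTo)
open import Data.List.Properties using (foldl-∷ʳ; map-++; upTo-∷ʳ)
open import Data.Product using (∃; ∃-syntax; _×_; _,_; proj₁; proj₂)
open import Data.Sum using (_⊎_; inj₁; inj₂)
open import Data.Empty using (⊥-elim)
open import Function using (_∘_)
open import Function.Bundles using (_⇔_; mk⇔; Equivalence)
open import Relation.Nullary using (¬_; Dec; yes; no)
open import Relation.Nullary.Decidable using (_⊎-dec_; _×-dec_; ¬?; decidable-stable)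
open import Relation.Unary using (Pred; Decidable)
open import Relation.Binary.PropositionalEquality
  using (_≡_; _≢_; refl; sym; trans; cong; cong₂; subst; module ≡-Reasoning)

run : ∀ {A B : Set} → (B → A → B) → B → (ℕ → A) → ℕ → B
run h b u zero    = b
run h b u (suc n) = h (run h b u n) (u n)

map-upTo-suc : ∀ {A : Set} (u : ℕ → A) n → map u (upTo (suc n)) ≡ map u (upTo n) ∷ʳ u n
map-upTo-suc u n = trans (cong (map u) (sym (upTo-∷ʳ n))) (map-++ u (upTo n) (n ∷ []))

foldl-map-upTo : ∀ {A B : Set} (h : B → A → B) b (u : ℕ → A) n →
                 foldl h b (map u (upTo n)) ≡ run h b u n
foldl-map-upTo h b u zero    = refl
foldl-map-upTo h b u (suc n) = begin
  foldl h b (map u (upTo (suc n)))   ≡⟨ cong (foldl h b) (map-upTo-suc u n) ⟩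
  foldl h b (map u (upTo n) ∷ʳ u n)  ≡⟨ foldl-∷ʳ h b (u n) (map u (upTo n)) ⟩
  h (foldl h b (map u (upTo n))) (u n) ≡⟨ cong (λ c → h c (u n)) (foldl-map-upTo h b u n) ⟩
  run h b u (suc n)                  ∎
  where open ≡-Reasoning

module _ {n p} {P : Pred (Subset n) p} (P? : Decidable P) where

  allSubset? : Dec (∀ X → P X)
  allSubset? with anySubset? (¬? ∘ P?)
  ... | yes (X , ¬PX) = no λ ∀P → ¬PX (∀P X)
  ... | no ¬∃¬P      = yes λ X → decidable-stable (P? X) λ ¬PX → ¬∃¬P (X , ¬PX)

  ¬∀⇒∃¬-Subset : ¬ (∀ X → P X) → ∃ λ X → ¬ P X
  ¬∀⇒∃¬-Subset ¬∀P = decidable-stable (anySubset? (¬? ∘ P?))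
    λ ¬∃¬P → ¬∀P λ X → decidable-stable (P? X) λ ¬PX → ¬∃¬P (X , ¬PX)

letter : ∀ {nx ny} → Strategy nx ny → (ℕ → Subset nx) → ℕ → Letter nx ny
letter g Xs i = Xs i , g (prefix Xs i)

module SymbolicRun {nx ny nz} (ℱ : SymAut nx ny nz) where
  open SymAut ℱ

  η-step : Subset nz → Letter nx ny → Subset nz
  η-step Z (X , Y) = η X Y Z

  η* : Subset nz → List (Letter nx ny) → Subset nz
  η* = foldl η-step

  η*-play : ∀ Z g Xs k → η* Z (play g Xs k) ≡ run η-step Z (letter g Xs) (suc k)
  η*-play Z g Xs k = foldl-map-upTo η-step Z (letter g Xs) (suc k)

  SymRecognizes : LTLf nx ny → Set
  SymRecognizes φ = ∀ w → Models w φ ⇔ (f (η* Z₀ w) ≡ true)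

  ¬f-Z₀ : ∀ {φ} → SymRecognizes φ → f Z₀ ≢ true
  ¬f-Z₀ recognizes fZ₀ with proj₁ (Equivalence.from (recognizes []) fZ₀)
  ... | ()

open SymbolicRun

module _ {nx ny} {G : DFA nx ny} {ℱ : SymAut nx ny ⌈log₂ DFA.m G ⌉} (E : Encodes G ℱ) where
  open DFA G
  open SymAut ℱ
  open Encodes E

  enc-δ* : ∀ s w → enc (δ* G s w) ≡ η* ℱ (enc s) w
  enc-δ* s []             = refl
  enc-δ* s ((X , Y) ∷ w) = trans (enc-δ* (δ s (X , Y)) w) (cong (λ Z → η* ℱ Z w) (sym (η-enc X Y s)))

  enc-η*-Z₀ : ∀ w → enc (δ* G s₀ w) ≡ η* ℱ Z₀ w
  enc-η*-Z₀ w = trans (enc-δ* s₀ w) (cong (λ Z → η* ℱ Z w) (sym Z₀-enc))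

  accepts⇔f : ∀ w → Accepts G w ⇔ (f (η* ℱ Z₀ w) ≡ true)
  accepts⇔f w = mk⇔
    (λ s∈F → Equivalence.from (f-enc _) (_ , enc-η*-Z₀ w , s∈F))
    (λ fZ → let s , enc-s , s∈F = Equivalence.to (f-enc _) fZ
            in subst (_∈ F) (enc-inj (trans enc-s (sym (enc-η*-Z₀ w)))) s∈F)

  encodes-symRecognizes : ∀ {φ} → Recognizes G φ → SymRecognizes ℱ φ
  encodes-symRecognizes recognizes w = mk⇔
    (Equivalence.to (accepts⇔f w) ∘ Equivalence.from (recognizes w))
    (Equivalence.to (recognizes w) ∘ Equivalence.from (accepts⇔f w))

module FixpointProperties {nx ny nz} (ℱ : SymAut nx ny nz) where
  open SymAut ℱ
  open Fixpoint ℱ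

  mutual
    t? : ∀ i Z Y → Dec (t i Z Y)
    t? zero    Z Y = f Z ≟ᵇ true
    t? (suc i) Z Y = t? i Z Y ⊎-dec (¬? (w? i Z) ×-dec allSubset? λ X → w? i (η X Y Z))

    w? : ∀ i Z → Dec (w i Z)
    w? zero    Z = f Z ≟ᵇ true
    w? (suc i) Z = anySubset? (t? (suc i) Z)

  w⇒∃t : ∀ i {Z} → w i Z → ∃[ Y ] t i Z Y
  w⇒∃t zero    fZ  = ⊥ , fZ
  w⇒∃t (suc i) ∃tZ = ∃tZ

  w-suc : ∀ i {Z} → w i Z → w (suc i) Z
  w-suc i wZ = let Y , tZY = w⇒∃t i wZ in Y , inj₁ tZY

  w-mono : ∀ {i j Z} → i ≤ j → w i Z → w j Z
  w-mono = go ∘ ≤⇒≤′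
    where
    go : ∀ {i j Z} → i ≤′ j → w i Z → w j Z
    go ≤′-refl        wZ = wZ
    go (≤′-step i≤′j) wZ = w-suc _ (go i≤′j wZ)

  f⇒w : ∀ i {Z} → f Z ≡ true → w i Z
  f⇒w i = w-mono z≤n

  Forces : ℕ → Subset nz → Subset ny → Set
  Forces i Z Y = ∀ X → w i (η X Y Z)

  t⇒f⊎forces : ∀ i {Z Y} → t i Z Y → f Z ≡ true ⊎ ∃[ j ] (¬ w j Z × Forces j Z Y)
  t⇒f⊎forces zero    fZ                  = inj₁ fZ
  t⇒f⊎forces (suc i) (inj₁ tZY)          = t⇒f⊎forces i tZY
  t⇒f⊎forces (suc i) (inj₂ (¬wZ , forces)) = inj₂ (i , ¬wZ , forces)

module TransducerWins {nx ny nz} (ℱ : SymAut nx ny nz) {N : ℕ} {τ : Subset nz → Subset ny}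
                      (synth : Fixpoint.BoolSynth ℱ N τ) where
  open SymAut ℱ
  open Fixpoint ℱ
  open FixpointProperties ℱ

  τ-descends : ∀ {i Z} → suc i ≤ N → w (suc i) Z → f Z ≡ true ⊎ Forces i Z (τ Z)
  τ-descends {i} {Z} i<N wZ with t⇒f⊎forces N (synth Z (w⇒∃t N (w-mono i<N wZ)))
  ... | inj₁ fZ = inj₁ fZ
  ... | inj₂ (j , ¬wjZ , forces) with j ≤? i
  ...   | yes j≤i = inj₂ λ X → w-mono j≤i (forces X)
  ...   | no  j≰i = ⊥-elim (¬wjZ (w-mono (≰⇒> j≰i) wZ))

  reaches-f : ∀ Z Xs i → i ≤ N → ∀ j → w i (run (ζ ℱ τ) Z Xs j) →
              ∃[ k ] f (run (ζ ℱ τ) Z Xs k) ≡ true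
  reaches-f Z Xs zero    _   j fZj = j , fZj
  reaches-f Z Xs (suc i) i<N j wZj with τ-descends i<N wZj
  ... | inj₁ fZj   = j , fZj
  ... | inj₂ forces = reaches-f Z Xs i (<⇒≤ i<N) (suc j) (forces (Xs j))

  run-transducer : ∀ Xs i →
    run (η-step ℱ) Z₀ (letter (transducerStrategy ℱ τ) Xs) i ≡ run (ζ ℱ τ) Z₀ Xs i
  run-transducer Xs zero    = refl
  run-transducer Xs (suc i) =
    cong₂ (λ Y Z → η (Xs i) Y Z) (cong τ (foldl-map-upTo (ζ ℱ τ) Z₀ Xs i)) (run-transducer Xs i)

  transducer-wins : ∀ {φ} → SymRecognizes ℱ φ → w N Z₀ → Winning φ (transducerStrategy ℱ τ)
  transducer-wins recognizes wZ₀ Xs with reaches-f Z₀ Xs N ≤-refl 0 wZ₀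
  -- Run index suc k corresponds to play k; index 0 would be the empty trace.
  ... | zero  , fZ₀ = ⊥-elim (¬f-Z₀ ℱ recognizes fZ₀)
  ... | suc k , fZk = k , Equivalence.from (recognizes _)
    (subst (λ Z → f Z ≡ true)
           (sym (trans (η*-play ℱ Z₀ (transducerStrategy ℱ τ) Xs k) (run-transducer Xs (suc k))))
           fZk)

module Spoiler {nx ny nz} (ℱ : SymAut nx ny nz) (Trap : Subset nz → Set)
               (escape : ∀ {Z} → Trap Z → ∀ Y → ∃[ X ] Trap (SymAut.η ℱ X Y Z))
               (g : Strategy nx ny) {Z₀ : Subset nz} (trap-Z₀ : Trap Z₀) where
  open SymAut ℱ hiding (Z₀)

  record Position : Set where
    field
      history : List (Subset nx)
      state   : Subset nz
      trapped : Trap state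

    reply : ∃[ X ] Trap (η X (g history) state)
    reply = escape trapped (g history)

  next : Position → Position
  next p = record
    { history = history ∷ʳ proj₁ reply
    ; state   = η (proj₁ reply) (g history) state
    ; trapped = proj₂ reply
    }
    where open Position p

  position : ℕ → Position
  position zero    = record { history = [] ; state = Z₀ ; trapped = trap-Z₀ }
  position (suc i) = next (position i)

  spoiler : ℕ → Subset nx
  spoiler i = proj₁ (Position.reply (position i))

  history-prefix : ∀ i → Position.history (position i) ≡ prefix spoiler i
  history-prefix zero    = refl
  history-prefix (suc i) =
    trans (cong (_∷ʳ spoiler i) (history-prefix i)) (sym (map-upTo-suc spoiler i))

  state-run : ∀ i → Position.state (position i) ≡ run (η-step ℱ) Z₀ (letter g spoiler) i
  state-run zero    = refl
  state-run (suc i) = cong₂ (λ Y Z → η (spoiler i) Y Z) (cong g (history-prefix i)) (state-run i)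

  spoiler-traps : ∀ k → Trap (η* ℱ Z₀ (play g spoiler k))
  spoiler-traps k = subst Trap (trans (state-run (suc k)) (sym (η*-play ℱ Z₀ g spoiler k)))
                              (Position.trapped (position (suc k)))

module Realizability {nx ny nz} (ℱ : SymAut nx ny nz) {N : ℕ}
                     (stable : Fixpoint.Stable ℱ N) where
  open SymAut ℱ
  open Fixpoint ℱ
  open FixpointProperties ℱ

  escape : ∀ {Z} → ¬ w N Z → ∀ Y → ∃[ X ] ¬ w N (η X Y Z)
  escape {Z} ¬wZ Y = ¬∀⇒∃¬-Subset (λ X → w? N (η X Y Z))
    λ forces → ¬wZ (Equivalence.to (stable Z) (Y , inj₂ (¬wZ , forces)))

  realizable⇒w-Z₀ : ∀ {φ} → SymRecognizes ℱ φ → Realizable φ → w N Z₀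
  realizable⇒w-Z₀ recognizes (g , g-wins) = decidable-stable (w? N Z₀) λ ¬wZ₀ →
    let open Spoiler ℱ (λ Z → ¬ w N Z) escape g ¬wZ₀
        k , models = g-wins spoiler
    in spoiler-traps k (f⇒w N (Equivalence.to (recognizes _) models))

mainTheorem2 : ∀ {nx ny} (φ : LTLf nx ny) (G : DFA nx ny) → Recognizes G φ →
    (ℱ : SymAut nx ny ⌈log₂ DFA.m G ⌉) → Encodes G ℱ →
    (N : ℕ) → Fixpoint.IsFixpointIndex ℱ N →
    (τ : Subset ⌈log₂ DFA.m G ⌉ → Subset ny) → Fixpoint.BoolSynth ℱ N τ →
    Realizable φ → Winning φ (transducerStrategy ℱ τ)
mainTheorem2 φ G recognizes ℱ E N (stable , _) τ synth realizable =
  TransducerWins.transducer-wins ℱ synth symRecognizes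
    (Realizability.realizable⇒w-Z₀ ℱ stable symRecognizes realizable)
  where
  symRecognizes : SymRecognizes ℱ φ
  symRecognizes = encodes-symRecognizes E recognizes
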